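{- Assume the Erdős Girth Conjecture. Then for every integer $k\ge 1$, every $n$-vertex hypergraph with nonnegative hyperedge weights has a $(2k-1)$-hyperspanner with $O(n^{1+1/k})$ hyperedges, and this bound is tight: there are $n$-vertex hypergraphs for which every $(2k-1)$-hyperspanner has $\Omega(n^{1+1/k})$ hyperedges. That is, the optimal worst-case size of $(2k-1)$-hyperspanners is $\Theta(n^{1+1/k})$.
   Context: A sub-hypergraph $H'=(V,E')$, $E'\subseteq E$, of a weighted hypergraph $H=(V,E,w)$ is a $t$-hyperspanner if $\delta_{H'}(u,v)\le t\,\delta_H(u,v)$ for all $u,v\in V$, where a $u$–$v$ path is a sequence $u=x_0,\dots,x_\ell=v$ with hyperedges $h_1,\dots,h_\ell$, $x_{j-1},x_j\in h_j$, of length $\sum_j w(h_j)$, and $\delta$ is the minimum such length. The Erdős Girth Conjecture states that for every integer $k\ge1$ there exist $n$-vertex graphs of girth greater than $2k$ with $\Omega(n^{1+1/k})$ edges.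
   Formalization: The hyperedge weights are nonnegative rationals. -}

module Defs where

open import Data.Nat as ℕ using (ℕ; zero; suc; _∸_; _^_)
open import Data.Integer using (+_)
open import Data.Rational as ℚ using (ℚ; 0ℚ; _/_)
open import Data.Fin using (Fin; toℕ)
open import Data.Fin.Subset using (Subset; _∈_; ∣_∣)
open import Data.Product using (Σ; ∃; _×_; _,_)
open import Data.Sum using (_⊎_)
open import Data.Unit using (⊤)
open import Relation.Nullary using (¬_)
open import Relation.Binary.PropositionalEquality using (_≡_)

record Hypergraph (n : ℕ) : Set where
  field
    m      : ℕ
    edge   : Fin m → Subset n
    weight : Fin m → ℚ

open Hypergraph public

NonnegWeights : ∀ {n} → Hypergraph n → Set
NonnegWeights H = ∀ h → 0ℚ ℚ.≤ weight H h

-- u–v paths x₀ = u, …, x_ℓ = v with hyperedges h₁ … h_ℓ,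
-- x_{j-1}, x_j ∈ h_j, using only hyperedges in `Allowed`;
-- the ℚ index is the length ∑ w(h_j).
data Path {n} (H : Hypergraph n) (Allowed : Fin (m H) → Set)
          : Fin n → Fin n → ℚ → Set where
  []   : ∀ {u} → Path H Allowed u u 0ℚ
  cons : ∀ {u x v L} (h : Fin (m H)) → Allowed h →
         u ∈ edge H h → x ∈ edge H h →
         Path H Allowed x v L → Path H Allowed u v (weight H h ℚ.+ L)

PathH : ∀ {n} (H : Hypergraph n) → Fin n → Fin n → ℚ → Set
PathH H = Path H (λ _ → ⊤)

PathSub : ∀ {n} (H : Hypergraph n) → Subset (m H) → Fin n → Fin n → ℚ → Set
PathSub H S = Path H (λ h → h ∈ S)

ℕ→ℚ : ℕ → ℚ
ℕ→ℚ t = + t / 1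

-- H' = (V, E'), E' = S ⊆ E, is a t-hyperspanner of H:
-- δ_{H'}(u,v) ≤ t · δ_H(u,v) for all u, v, i.e. for every u–v path in H
-- of length L there is a u–v path in H' of length ≤ t · L.
IsHyperspanner : ∀ {n} (t : ℕ) (H : Hypergraph n) → Subset (m H) → Set
IsHyperspanner t H S =
  ∀ u v L → PathH H u v L →
  Σ ℚ λ L' → PathSub H S u v L' × (L' ℚ.≤ ℕ→ℚ t ℚ.* L)

-- Simple graphs on Fin n: m edges, each an ordered pair (a , b) with
-- a < b (so no loops), pairwise distinct (so no multi-edges).

record Graph (n : ℕ) : Set where
  field
    ne     : ℕ
    ends   : Fin ne → Fin n × Fin n
    proper : ∀ e → toℕ (Data.Product.proj₁ (ends e)) ℕ.< toℕ (Data.Product.proj₂ (ends e))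
    distinct : ∀ e e' → ends e ≡ ends e' → e ≡ e'

open Graph public

Adj : ∀ {n} → Graph n → Fin n → Fin n → Set
Adj G a b = Σ (Fin (ne G)) λ e → (ends G e ≡ (a , b)) ⊎ (ends G e ≡ (b , a))

HasCycle : ∀ {n} → Graph n → ℕ → Set
HasCycle {n} G ℓ =
  Σ (ℕ → Fin n) λ c →
    (∀ i j → i ℕ.< ℓ → j ℕ.< ℓ → c i ≡ c j → i ≡ j) ×
    (c ℓ ≡ c 0) ×
    (∀ i → i ℕ.< ℓ → Adj G (c i) (c (suc i)))

GirthGreaterThan : ∀ {n} → Graph n → ℕ → Set
GirthGreaterThan G g = ∀ ℓ → 3 ℕ.≤ ℓ → ℓ ℕ.≤ g → ¬ HasCycle G ℓ

-- Erdős Girth Conjecture: for every k ≥ 1 there are n-vertex graphs of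
-- girth > 2k with Ω(n^{1+1/k}) edges, i.e. there are D ≥ 1 and n₀ such
-- that for all n ≥ n₀ some such graph has |E| ≥ n^{1+1/k} / D, written
-- without roots as n^{k+1} ≤ D^k · |E|^k.
ErdosGirthConjecture : Set
ErdosGirthConjecture =
  ∀ (k : ℕ) → 1 ℕ.≤ k →
  Σ ℕ λ D → 1 ℕ.≤ D × Σ ℕ λ n₀ → ∀ n → n₀ ℕ.≤ n →
  Σ (Graph n) λ G → GirthGreaterThan G (2 ℕ.* k) ×
    (n ^ (k ℕ.+ 1) ℕ.≤ D ^ k ℕ.* ne G ^ k)

{-# OPTIONS --safe #-}
-- Scan the triples (u, v, h) with u, v ∈ h by increasing weight of h, and add the
-- edge uv to a graph G unless u and v are already joined in G by a walk of at most t = 2k - 1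
-- edges.  Every edge of G added so far lies in a hyperedge no heavier than h, so in either case u
-- and v are joined by a path of weight ≤ t · w(h) through the lightest hyperedges containing the
-- edges of G; these hyperedges form the spanner.  No edge ab of G has a detour of at most t edges
-- avoiding it, i.e. G has girth > 2k, and the Moore bound gives |E(G)|^k ≤ 4^k n^{k+1}: if
-- |E(G)| > (c + 1) n, pruning vertices of degree ≤ c leaves a core of minimum degree c + 1, in
-- which the non-backtracking walks of length k from one vertex end at c^k distinct vertices.
--
-- View a graph of girth > 2k as a hypergraph with unit weights.  If a
-- (2k-1)-spanner omits an edge ab, it joins a and b by a path of length ≤ 2k - 1 avoiding ab,
-- which closes a cycle of length ≤ 2k; so every spanner keeps all edges.
module Submission where

open import Defs
open import Data.Nat as ℕ using (ℕ; zero; suc; _+_; _*_; _∸_; _^_; _≤_; _<_; _≰_; z≤n; s≤s; _≤?_)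
import Data.Nat.Properties as ℕ
open import Data.Nat.DivMod using (_/_; m≡m%n+[m/n]*n; m%n<n; m/n*n≤m)
open import Data.Nat.Coprimality using (1-coprimeTo) renaming (sym to coprime-sym)
open import Data.Nat.Tactic.RingSolver using (solve-∀)
open import Data.Integer as ℤ using (+_)
import Data.Integer.Properties as ℤ
open import Data.Rational as ℚ using (ℚ; 0ℚ; 1ℚ; mkℚ)
import Data.Rational.Properties as ℚ
open import Data.Bool using (Bool; true; false; T; _∨_)
open import Data.Bool.Properties using (T-∨)
open import Data.Maybe using (Maybe; just; nothing)
open import Data.Fin using (Fin; zero; toℕ; _≟_; remQuot; combine)
open import Data.Fin.Properties using (toℕ<n; toℕ-injective; combine-remQuot; injective⇒≤; any?)
open import Data.Fin.Subset using (Subset; _∈_; _∉_; ⁅_⁆; _∪_; ⊤; ⋃; ∣_∣; inside; outside)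
import Data.Fin.Subset.Properties as Subset
open import Data.Vec using ([]; _∷_)
open import Data.List using (List; []; _∷_; _++_; length; map; filter; mapMaybe; allFin; cartesianProduct)
open import Data.List.Properties using (length-++; length-++-sucʳ; length-mapMaybe; length-tabulate; ∷-injectiveˡ; ∷-injectiveʳ)
open import Data.List.Membership.Propositional using (find) renaming (_∈_ to _∈ˡ_; _∉_ to _∉ˡ_)
open import Data.List.Membership.Propositional.Properties using (∈-allFin; ∈-∃++; ∈-++⁺ˡ; ∈-++⁺ʳ; ∈-filter⁺; ∈-filter⁻; ∈-cartesianProduct⁺)
open import Data.List.Membership.DecPropositional using (_∈?_)
open import Data.List.Relation.Unary.Any using (here; there)
open import Data.List.Relation.Unary.All using (All; []; _∷_; all?; lookup)
import Data.List.Relation.Unary.All as All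
open import Data.List.Relation.Unary.All.Properties using (¬Any⇒All¬; ¬All⇒Any¬; ++⁻ˡ; ++⁻ʳ; ++⁺; all-filter)
open import Data.List.Relation.Unary.AllPairs using (AllPairs; []; _∷_)
open import Data.List.Relation.Unary.Linked.Properties using (Linked⇒AllPairs)
open import Data.List.Relation.Unary.Unique.Propositional using (Unique)
open import Data.List.Relation.Unary.Unique.Propositional.Properties using (Unique[x∷xs]⇒x∉xs; filter⁺; allFin⁺)
open import Data.List.Relation.Binary.Permutation.Propositional using (↭-sym)
open import Data.List.Relation.Binary.Permutation.Propositional.Properties using (All-resp-↭; ∈-resp-↭)
import Data.List.Sort as Sort
open import Data.Product using (Σ; ∃; ∃₂; _×_; _,_; proj₁; proj₂; uncurry)
open import Data.Sum as Sum using (_⊎_; inj₁; inj₂)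
open import Data.Empty using (⊥-elim)
open import Data.Unit using (tt)
open import Function using (_∘_; id)
open import Function.Bundles using (Equivalence)
open import Relation.Binary.Bundles using (DecTotalOrder)
open import Relation.Binary.Definitions using (DecidableEquality)
import Relation.Binary.Construct.On as On
open import Relation.Binary.PropositionalEquality
open import Relation.Nullary using (¬_; Dec; yes; no; contradiction)
open import Relation.Nullary.Decidable using (⌊_⌋; toWitness; fromWitness; T?; _×-dec_; _⊎-dec_)
import Data.List.Extrema (DecTotalOrder.totalOrder ℚ.≤-decTotalOrder) as Extrema

module _ {A : Set} where

  nthOr : A → List A → ℕ → A
  nthOr d []       _       = d
  nthOr d (x ∷ xs) zero    = x
  nthOr d (x ∷ xs) (suc i) = nthOr d xs i

  nthOr-∈ : ∀ d xs {i} → i < length xs → nthOr d xs i ∈ˡ xs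
  nthOr-∈ d (x ∷ xs) {zero}  _         = here refl
  nthOr-∈ d (x ∷ xs) {suc i} (s≤s i<n) = there (nthOr-∈ d xs i<n)

  nthOr-injective : ∀ d {xs} → Unique xs → ∀ {i j} → i < length xs → j < length xs →
                    nthOr d xs i ≡ nthOr d xs j → i ≡ j
  nthOr-injective d _ {zero} {zero} _ _ _ = refl
  nthOr-injective d {x ∷ xs} u {zero} {suc j} _ (s≤s j<n) x≡ =
    ⊥-elim (Unique[x∷xs]⇒x∉xs u (subst (_∈ˡ xs) (sym x≡) (nthOr-∈ d xs j<n)))
  nthOr-injective d {x ∷ xs} u {suc i} {zero} (s≤s i<n) _ ≡x =
    ⊥-elim (Unique[x∷xs]⇒x∉xs u (subst (_∈ˡ xs) ≡x (nthOr-∈ d xs i<n)))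
  nthOr-injective d (_ ∷ u) {suc i} {suc j} (s≤s i<n) (s≤s j<n) eq =
    cong suc (nthOr-injective d u i<n j<n eq)

  Unique-++⁻ʳ : ∀ (xs : List A) {ys} → Unique (xs ++ ys) → Unique ys
  Unique-++⁻ʳ []       u       = u
  Unique-++⁻ʳ (_ ∷ xs) (_ ∷ u) = Unique-++⁻ʳ xs u

  Unique-++-∷⁻ : ∀ (xs : List A) {x ys} → Unique (xs ++ x ∷ ys) → Unique (xs ++ ys)
  Unique-++-∷⁻ []       (_ ∷ u)  = u
  Unique-++-∷⁻ (_ ∷ xs) (z≢ ∷ u) = ++⁺ (++⁻ˡ xs z≢) (All.tail (++⁻ʳ xs z≢)) ∷ Unique-++-∷⁻ xs u

  ∈-mapMaybe⁺ : ∀ {B : Set} (f : A → Maybe B) {xs x y} → x ∈ˡ xs → f x ≡ just y → y ∈ˡ mapMaybe f xs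
  ∈-mapMaybe⁺ f {x ∷ xs} (here refl) fx≡ rewrite fx≡ = here refl
  ∈-mapMaybe⁺ f {x ∷ xs} (there x∈)  fx≡ with f x
  ... | nothing = ∈-mapMaybe⁺ f x∈ fx≡
  ... | just _  = there (∈-mapMaybe⁺ f x∈ fx≡)

∣p∪q∣≤∣p∣+∣q∣ : ∀ {n} (p q : Subset n) → ∣ p ∪ q ∣ ≤ ∣ p ∣ + ∣ q ∣
∣p∪q∣≤∣p∣+∣q∣ []            []            = z≤n
∣p∪q∣≤∣p∣+∣q∣ (inside ∷ p)  (inside ∷ q)  = s≤s (ℕ.≤-trans (∣p∪q∣≤∣p∣+∣q∣ p q) (ℕ.+-monoʳ-≤ ∣ p ∣ (ℕ.n≤1+n ∣ q ∣)))
∣p∪q∣≤∣p∣+∣q∣ (inside ∷ p)  (outside ∷ q) = s≤s (∣p∪q∣≤∣p∣+∣q∣ p q)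
∣p∪q∣≤∣p∣+∣q∣ (outside ∷ p) (inside ∷ q)  = ℕ.≤-trans (s≤s (∣p∪q∣≤∣p∣+∣q∣ p q)) (ℕ.≤-reflexive (sym (ℕ.+-suc ∣ p ∣ ∣ q ∣)))
∣p∪q∣≤∣p∣+∣q∣ (outside ∷ p) (outside ∷ q) = ∣p∪q∣≤∣p∣+∣q∣ p q

fromList : ∀ {n} → List (Fin n) → Subset n
fromList = ⋃ ∘ map ⁅_⁆

∣fromList∣≤length : ∀ {n} (xs : List (Fin n)) → ∣ fromList xs ∣ ≤ length xs
∣fromList∣≤length {n} []       = ℕ.≤-reflexive (Subset.∣⊥∣≡0 n)
∣fromList∣≤length       (x ∷ xs) = ℕ.≤-trans (∣p∪q∣≤∣p∣+∣q∣ ⁅ x ⁆ (fromList xs))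
  (ℕ.≤-trans (ℕ.≤-reflexive (cong (_+ ∣ fromList xs ∣) (Subset.∣⁅x⁆∣≡1 x))) (s≤s (∣fromList∣≤length xs)))

∈-fromList : ∀ {n} {x : Fin n} {xs} → x ∈ˡ xs → x ∈ fromList xs
∈-fromList {x = x} (here refl) = Subset.x∈p∪q⁺ (inj₁ (Subset.x∈⁅x⁆ x))
∈-fromList         (there x∈)  = Subset.x∈p∪q⁺ (inj₂ (∈-fromList x∈))

-- The index ℓ of Walk R ℓ x y only bounds the number of steps.
data Walk {V : Set} (R : V → V → Set) : ℕ → V → V → Set where
  ε   : ∀ {ℓ x} → Walk R ℓ x x
  _◅_ : ∀ {ℓ x y z} → R x y → Walk R ℓ y z → Walk R (suc ℓ) x z

infixr 5 _◅_

module _ {V : Set} where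

  private variable
    R R′ : V → V → Set
    ℓ ℓ′ : ℕ
    x y z : V

  vertices : Walk R ℓ x y → List V
  vertices {x = x} ε       = x ∷ []
  vertices {x = x} (_ ◅ w) = x ∷ vertices w

  weaken : ℓ ≤ ℓ′ → Walk R ℓ x y → Walk R ℓ′ x y
  weaken _          ε       = ε
  weaken (s≤s ℓ≤ℓ′) (r ◅ w) = r ◅ weaken ℓ≤ℓ′ w

  vertices-weaken : (ℓ≤ℓ′ : ℓ ≤ ℓ′) (w : Walk R ℓ x y) → vertices (weaken ℓ≤ℓ′ w) ≡ vertices w
  vertices-weaken _          ε       = refl
  vertices-weaken (s≤s ℓ≤ℓ′) (_ ◅ w) = cong (_ ∷_) (vertices-weaken ℓ≤ℓ′ w)

  mapWalk : (∀ {x y} → R x y → R′ x y) → Walk R ℓ x y → Walk R′ ℓ x y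
  mapWalk f ε       = ε
  mapWalk f (r ◅ w) = f r ◅ mapWalk f w

  infixr 5 _◅◅_

  _◅◅_ : Walk R ℓ x y → Walk R ℓ′ y z → Walk R (ℓ + ℓ′) x z
  _◅◅_ {ℓ = ℓ} ε w′ = weaken (ℕ.m≤n+m _ ℓ) w′
  (r ◅ w) ◅◅ w′      = r ◅ (w ◅◅ w′)

  _▻_ : Walk R ℓ x y → R y z → Walk R (suc ℓ) x z
  ε        ▻ r = r ◅ ε
  (r′ ◅ w) ▻ r = r′ ◅ (w ▻ r)

  reverse : (∀ {x y} → R x y → R y x) → Walk R ℓ x y → Walk R ℓ y x
  reverse sym ε       = ε
  reverse sym (r ◅ w) = reverse sym w ▻ sym r

  steps : Walk R ℓ x y → ℕ
  steps ε       = 0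
  steps (_ ◅ w) = suc (steps w)

  steps≤ : (w : Walk R ℓ x y) → steps w ≤ ℓ
  steps≤ ε       = z≤n
  steps≤ (_ ◅ w) = s≤s (steps≤ w)

  length-vertices : (w : Walk R ℓ x y) → length (vertices w) ≡ suc (steps w)
  length-vertices ε       = refl
  length-vertices (_ ◅ w) = cong suc (length-vertices w)

  nthOr-vertices-step : (w : Walk R ℓ x y) → ∀ d {i} → i < steps w →
                        R (nthOr d (vertices w) i) (nthOr d (vertices w) (suc i))
  nthOr-vertices-step (r ◅ ε)       d {zero}  _         = r
  nthOr-vertices-step (r ◅ (_ ◅ _)) d {zero}  _         = r
  nthOr-vertices-step (_ ◅ w)       d {suc i} (s≤s i<n) = nthOr-vertices-step w d i<n

  nthOr-vertices-first : (w : Walk R ℓ x y) → ∀ d → nthOr d (vertices w) 0 ≡ x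
  nthOr-vertices-first ε       d = refl
  nthOr-vertices-first (_ ◅ w) d = refl

  nthOr-vertices-last : (w : Walk R ℓ x y) → ∀ d → nthOr d (vertices w) (steps w) ≡ y
  nthOr-vertices-last ε       d = refl
  nthOr-vertices-last (_ ◅ w) d = nthOr-vertices-last w d

  nthOr-vertices-beyond : (w : Walk R ℓ x y) → ∀ d → nthOr d (vertices w) (suc (steps w)) ≡ d
  nthOr-vertices-beyond ε       d = refl
  nthOr-vertices-beyond (_ ◅ w) d = nthOr-vertices-beyond w d

  module _ (_≟_ : DecidableEquality V) where

    suffixFrom : (w : Walk R ℓ x z) → y ∈ˡ vertices w →
                 Σ (Walk R ℓ y z) λ w′ → ∃ λ pre → vertices w ≡ pre ++ vertices w′
    suffixFrom ε       (here refl) = ε , [] , refl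
    suffixFrom (r ◅ w) (here refl) = r ◅ w , [] , refl
    suffixFrom {ℓ = suc ℓ} {x = x} (_ ◅ w) (there y∈) with suffixFrom w y∈
    ... | w′ , pre , eq = weaken (ℕ.n≤1+n ℓ) w′ , x ∷ pre ,
                          cong (x ∷_) (trans eq (cong (pre ++_) (sym (vertices-weaken _ w′))))

    loopErase : Walk R ℓ x y → Σ (Walk R ℓ x y) (Unique ∘ vertices)
    loopErase ε = ε , [] ∷ []
    loopErase {ℓ = suc ℓ} {x = x} (r ◅ w) with loopErase w
    ... | w′ , u with _∈?_ _≟_ x (vertices w′)
    ...   | no x∉  = r ◅ w′ , ¬Any⇒All¬ _ x∉ ∷ u
    ...   | yes x∈ with suffixFrom w′ x∈
    ...     | w″ , pre , eq = weaken (ℕ.n≤1+n ℓ) w″ ,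
                              subst Unique (sym (vertices-weaken _ w″)) (Unique-++⁻ʳ pre (subst Unique eq u))

  -- Cut a walk at its first and last step outside R′.
  split-by : ∀ {P : V → Set} → (∀ {x y} → R x y → R′ x y ⊎ (P x × P y)) → Walk R ℓ x y →
             Walk R′ ℓ x y ⊎
             ∃₂ λ x₁ y₂ → ∃₂ λ p r → P x₁ × P y₂ × Walk R′ p x x₁ × Walk R′ r y₂ y × suc (p + r) ≤ ℓ
  split-by classify ε = inj₁ ε
  split-by classify (s ◅ w) with classify s | split-by classify w
  ... | inj₁ s′          | inj₁ w′ = inj₁ (s′ ◅ w′)
  ... | inj₁ s′          | inj₂ (x₁ , y₂ , p , r , Px₁ , Py₂ , pre , suf , ≤ℓ) =
    inj₂ (x₁ , y₂ , suc p , r , Px₁ , Py₂ , s′ ◅ pre , suf , s≤s ≤ℓ)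
  ... | inj₂ (Px , Py)   | inj₁ w′ = inj₂ (_ , _ , 0 , _ , Px , Py , ε , w′ , ℕ.≤-refl)
  ... | inj₂ (Px , _)    | inj₂ (_ , y₂ , p , r , _ , Py₂ , _ , suf , ≤ℓ) =
    inj₂ (_ , y₂ , 0 , r , Px , Py₂ , ε , suf , s≤s (ℕ.≤-trans (ℕ.m≤n+m r (suc p)) ≤ℓ))

ℕ→ℚ≡mkℚ : ∀ t → ℕ→ℚ t ≡ mkℚ (+ t) 0 (coprime-sym (1-coprimeTo t))
ℕ→ℚ≡mkℚ t = ℚ.normalize-coprime (coprime-sym (1-coprimeTo t))

ℕ→ℚ-+ : ∀ a b → ℕ→ℚ (a + b) ≡ ℕ→ℚ a ℚ.+ ℕ→ℚ b
ℕ→ℚ-+ a b rewrite ℕ→ℚ≡mkℚ a | ℕ→ℚ≡mkℚ b =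
  cong (ℚ._/ 1) (sym (cong₂ ℤ._+_ (ℤ.*-identityʳ (+ a)) (ℤ.*-identityʳ (+ b))))

ℕ→ℚ-mono-≤ : ∀ {a b} → a ≤ b → ℕ→ℚ a ℚ.≤ ℕ→ℚ b
ℕ→ℚ-mono-≤ {a} {b} a≤b rewrite ℕ→ℚ≡mkℚ a | ℕ→ℚ≡mkℚ b =
  ℚ.*≤* (subst₂ ℤ._≤_ (sym (ℤ.*-identityʳ (+ a))) (sym (ℤ.*-identityʳ (+ b))) (ℤ.+≤+ a≤b))

ℕ→ℚ-cancel-≤ : ∀ {a b} → ℕ→ℚ a ℚ.≤ ℕ→ℚ b → a ≤ b
ℕ→ℚ-cancel-≤ {a} {b} a≤b rewrite ℕ→ℚ≡mkℚ a | ℕ→ℚ≡mkℚ b =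
  ℤ.drop‿+≤+ (subst₂ ℤ._≤_ (ℤ.*-identityʳ (+ a)) (ℤ.*-identityʳ (+ b)) (ℚ.drop-*≤* a≤b))

_++ᴾ_ : ∀ {n} {H : Hypergraph n} {Allowed : Fin (m H) → Set} {u x v a b} →
        Path H Allowed u x a → Path H Allowed x v b → Path H Allowed u v (a ℚ.+ b)
_++ᴾ_ {b = b} [] Q = subst (Path _ _ _ _) (sym (ℚ.+-identityˡ b)) Q
_++ᴾ_ {H = H} {b = b} (cons {L = L} h allowed u∈ x∈ P) Q =
  subst (Path _ _ _ _) (sym (ℚ.+-assoc (weight H h) L b)) (cons h allowed u∈ x∈ (P ++ᴾ Q))

ℕ→ℚ-nonNeg : ∀ a → 0ℚ ℚ.≤ ℕ→ℚ a
ℕ→ℚ-nonNeg a = ℕ→ℚ-mono-≤ {0} {a} z≤n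

*-nonNeg : ∀ {p q} → 0ℚ ℚ.≤ p → 0ℚ ℚ.≤ q → 0ℚ ℚ.≤ p ℚ.* q
*-nonNeg {p} {q} 0≤p 0≤q =
  ℚ.nonNegative⁻¹ _ {{ℚ.nonNeg*nonNeg⇒nonNeg p {{ℚ.nonNegative 0≤p}} q {{ℚ.nonNegative 0≤q}}}}

ℕ→ℚ-suc-* : ∀ ℓ q → ℕ→ℚ (suc ℓ) ℚ.* q ≡ q ℚ.+ ℕ→ℚ ℓ ℚ.* q
ℕ→ℚ-suc-* ℓ q = begin
  ℕ→ℚ (1 + ℓ) ℚ.* q             ≡⟨ cong (ℚ._* q) (ℕ→ℚ-+ 1 ℓ) ⟩
  (1ℚ ℚ.+ ℕ→ℚ ℓ) ℚ.* q          ≡⟨ ℚ.*-distribʳ-+ q 1ℚ (ℕ→ℚ ℓ) ⟩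
  1ℚ ℚ.* q ℚ.+ ℕ→ℚ ℓ ℚ.* q      ≡⟨ cong (ℚ._+ ℕ→ℚ ℓ ℚ.* q) (ℚ.*-identityˡ q) ⟩
  q ℚ.+ ℕ→ℚ ℓ ℚ.* q             ∎
  where open ≡-Reasoning

-- Graphs of large girth need all their edges

graphHypergraph : ∀ {n} → Graph n → Hypergraph n
graphHypergraph G = record
  { m      = ne G
  ; edge   = λ e → ⁅ proj₁ (ends G e) ⁆ ∪ ⁅ proj₂ (ends G e) ⁆
  ; weight = λ _ → ℕ→ℚ 1
  }

graphHypergraph-nonneg : ∀ {n} (G : Graph n) → NonnegWeights (graphHypergraph G)
graphHypergraph-nonneg G _ = ℕ→ℚ-nonNeg 1

module _ {n} (G : Graph n) where

  private
    H : Hypergraph n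
    H = graphHypergraph G

  Joins : Fin (ne G) → Fin n → Fin n → Set
  Joins e x y = ends G e ≡ (x , y) ⊎ ends G e ≡ (y , x)

  Ascending : Fin n × Fin n → Set
  Ascending (a , b) = toℕ a < toℕ b

  AdjAvoiding : Fin (ne G) → Fin n → Fin n → Set
  AdjAvoiding e x y = Σ (Fin (ne G)) λ e′ → e′ ≢ e × Joins e′ x y

  ∈-edge⁻ : ∀ {x} e → x ∈ edge H e → x ≡ proj₁ (ends G e) ⊎ x ≡ proj₂ (ends G e)
  ∈-edge⁻ e x∈ with Subset.x∈p∪q⁻ ⁅ proj₁ (ends G e) ⁆ ⁅ proj₂ (ends G e) ⁆ x∈
  ... | inj₁ x∈₁ = inj₁ (Subset.x∈⁅y⁆⇒x≡y _ x∈₁)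
  ... | inj₂ x∈₂ = inj₂ (Subset.x∈⁅y⁆⇒x≡y _ x∈₂)

  joins-or-equal : ∀ {x y} e → x ∈ edge H e → y ∈ edge H e → x ≡ y ⊎ Joins e x y
  joins-or-equal {x} {y} e x∈ y∈ with x ≟ y | ∈-edge⁻ e x∈ | ∈-edge⁻ e y∈
  ... | yes x≡y | _         | _         = inj₁ x≡y
  ... | no _    | inj₁ refl | inj₂ refl = inj₂ (inj₁ refl)
  ... | no _    | inj₂ refl | inj₁ refl = inj₂ (inj₂ refl)
  ... | no x≢y  | inj₁ refl | inj₁ refl = contradiction refl x≢y
  ... | no x≢y  | inj₂ refl | inj₂ refl = contradiction refl x≢y

  path⇒walk : ∀ {S e} → e ∉ S → ∀ {u v L} → PathSub H S u v L →
              Σ ℕ λ s → ℕ→ℚ s ≡ L × Walk (AdjAvoiding e) s u v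
  path⇒walk e∉ [] = 0 , refl , ε
  path⇒walk {S} {e} e∉ (cons h h∈S u∈ x∈ P) with path⇒walk e∉ P | joins-or-equal h u∈ x∈
  ... | s , refl , w | inj₁ refl  = suc s , ℕ→ℚ-+ 1 s , weaken (ℕ.n≤1+n s) w
  ... | s , refl , w | inj₂ joins = suc s , ℕ→ℚ-+ 1 s , (h , h≢e , joins) ◅ w
    where
    h≢e : h ≢ e
    h≢e refl = e∉ h∈S

  closeCycle : ∀ {R : Fin n → Fin n → Set} → (∀ {x y} → R x y → Adj G x y) →
               ∀ {ℓ a b} (w : Walk R ℓ a b) → Unique (vertices w) → Adj G b a →
               HasCycle G (suc (steps w))
  closeCycle R⇒Adj {a = a} w simple b~a = c , injective , closes , adjacent
    where
    -- past the end of the walk, c returns to a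
    c : ℕ → Fin n
    c = nthOr a (vertices w)

    injective : ∀ i j → i < suc (steps w) → j < suc (steps w) → c i ≡ c j → i ≡ j
    injective i j i< j< = nthOr-injective a simple (subst (i <_) (sym (length-vertices w)) i<)
                                                  (subst (j <_) (sym (length-vertices w)) j<)

    closes : c (suc (steps w)) ≡ c 0
    closes = trans (nthOr-vertices-beyond w a) (sym (nthOr-vertices-first w a))

    adjacent : ∀ i → i < suc (steps w) → Adj G (c i) (c (suc i))
    adjacent i (s≤s i≤steps) with ℕ.m≤n⇒m<n∨m≡n i≤steps
    ... | inj₁ i<steps = R⇒Adj (nthOr-vertices-step w a i<steps)
    ... | inj₂ refl    = subst₂ (Adj G) (sym (nthOr-vertices-last w a)) (sym (nthOr-vertices-beyond w a)) b~a

  detour-steps : ∀ e {a b} → ends G e ≡ (a , b) → ∀ {ℓ} (w : Walk (AdjAvoiding e) ℓ a b) → 2 ≤ steps w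
  detour-steps e ends≡ ε = ⊥-elim (ℕ.<-irrefl refl (subst Ascending ends≡ (proper G e)))
  detour-steps e ends≡ ((e′ , e′≢e , inj₁ ends′) ◅ ε) =
    contradiction (distinct G e′ e (trans ends′ (sym ends≡))) e′≢e
  detour-steps e ends≡ ((e′ , e′≢e , inj₂ ends′) ◅ ε) =
    ⊥-elim (ℕ.<-asym (subst Ascending ends≡ (proper G e)) (subst Ascending ends′ (proper G e′)))
  detour-steps e ends≡ (_ ◅ _ ◅ _) = s≤s (s≤s z≤n)

  edge-has-no-detour : ∀ {t} → GirthGreaterThan G (suc t) → ∀ e {ℓ} → ℓ ≤ t →
                       ¬ Walk (AdjAvoiding e) ℓ (proj₁ (ends G e)) (proj₂ (ends G e))
  edge-has-no-detour girth e ℓ≤t w with loopErase _≟_ w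
  ... | w′ , simple = girth (suc (steps w′)) (s≤s (detour-steps e refl w′))
                            (s≤s (ℕ.≤-trans (steps≤ w′) ℓ≤t))
                            (closeCycle (λ (e′ , _ , joins) → e′ , joins) w′ simple (e , inj₂ refl))

  edge-path : ∀ e → PathH H (proj₁ (ends G e)) (proj₂ (ends G e)) (ℕ→ℚ 1 ℚ.+ 0ℚ)
  edge-path e =
    cons e tt (Subset.x∈p∪q⁺ (inj₁ (Subset.x∈⁅x⁆ _))) (Subset.x∈p∪q⁺ (inj₂ (Subset.x∈⁅x⁆ _))) []

  spanner-contains-edges : ∀ {t S} → GirthGreaterThan G (suc t) → IsHyperspanner t H S → ∀ e → e ∈ S
  spanner-contains-edges {t} {S} girth spanner e with e Subset.∈? S
  ... | yes e∈ = e∈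
  ... | no e∉ with spanner _ _ _ (edge-path e)
  ...   | L , P , L≤t*[1+0] with path⇒walk e∉ P
  ...     | s , refl , w =
    ⊥-elim (edge-has-no-detour girth e (ℕ→ℚ-cancel-≤ (subst (ℕ→ℚ s ℚ.≤_) t*[1+0]≡t L≤t*[1+0])) w)
    where
    t*[1+0]≡t : ℕ→ℚ t ℚ.* (ℕ→ℚ 1 ℚ.+ 0ℚ) ≡ ℕ→ℚ t
    t*[1+0]≡t = trans (cong (ℕ→ℚ t ℚ.*_) (ℚ.+-identityʳ (ℕ→ℚ 1))) (ℚ.*-identityʳ (ℕ→ℚ t))

  spanner-size : ∀ {t S} → GirthGreaterThan G (suc t) → IsHyperspanner t H S → ne G ≤ ∣ S ∣
  spanner-size {S = S} girth spanner = subst (_≤ ∣ S ∣) (Subset.∣⊤∣≡n (ne G))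
    (Subset.p⊆q⇒∣p∣≤∣q∣ {p = ⊤} (λ {e} _ → spanner-contains-edges girth spanner e))

2k≡1+[2k∸1] : ∀ {k} → 1 ≤ k → 2 * k ≡ suc (2 * k ∸ 1)
2k≡1+[2k∸1] {k} 1≤k = sym (ℕ.m+[n∸m]≡n (ℕ.≤-trans 1≤k (ℕ.m≤m+n k (k + 0))))

large-girth-hypergraph : ∀ {n k D} → 1 ≤ k →
                         (Σ (Graph n) λ G → GirthGreaterThan G (2 * k) × n ^ (k + 1) ≤ D ^ k * ne G ^ k) →
                         Σ (Hypergraph n) λ H → NonnegWeights H ×
                           (∀ S → IsHyperspanner (2 * k ∸ 1) H S → n ^ (k + 1) ≤ D ^ k * ∣ S ∣ ^ k)
large-girth-hypergraph {k = k} {D} 1≤k (G , girth , dense) =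
  graphHypergraph G , graphHypergraph-nonneg G , λ S spanner →
    ℕ.≤-trans dense (ℕ.*-monoʳ-≤ (D ^ k) (ℕ.^-monoˡ-≤ k (spanner-size G girth′ spanner)))
  where
  girth′ : GirthGreaterThan G (suc (2 * k ∸ 1))
  girth′ = subst (GirthGreaterThan G) (2k≡1+[2k∸1] 1≤k) girth

-- The Moore bound

record IsSimple {V : Set} (A : V → V → Bool) : Set where
  field
    symmetric  : ∀ {x y} → T (A x y) → T (A y x)
    irreflexive : ∀ {x} → ¬ T (A x x)

bit : Bool → ℕ
bit true  = 1
bit false = 0

module _ {V : Set} (A : V → V → Bool) where

  degree : V → List V → ℕ
  degree x []      = 0
  degree x (y ∷ U) = bit (A x y) + degree x U

  neighboursIn : V → List V → List V
  neighboursIn x = filter (λ y → T? (A x y))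

  length-neighboursIn : ∀ x U → length (neighboursIn x U) ≡ degree x U
  length-neighboursIn x []      = refl
  length-neighboursIn x (y ∷ U) with A x y
  ... | true  = cong suc (length-neighboursIn x U)
  ... | false = length-neighboursIn x U

  edges : List V → ℕ
  edges []      = 0
  edges (x ∷ U) = degree x U + edges U

  MinDegree : ℕ → List V → Set
  MinDegree d U = ∀ {x} → x ∈ˡ U → d ≤ degree x U

  OtherEdge : V → V → V → V → Set
  OtherEdge a b x y = T (A x y) × ¬ (x ≡ a × y ≡ b) × ¬ (x ≡ b × y ≡ a)

  -- Equivalently, the girth of A exceeds t + 1.
  DetourFree : ℕ → Set
  DetourFree t = ∀ {a b} → T (A a b) → ¬ Walk (OtherEdge a b) t a b

module Pruning {V : Set} {A : V → V → Bool} (simple : IsSimple A) where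

  open IsSimple simple

  bit-symmetric : ∀ x y → bit (A x y) ≡ bit (A y x)
  bit-symmetric x y with A x y in xy | A y x in yx
  ... | true  | true  = refl
  ... | false | false = refl
  ... | true  | false = ⊥-elim (subst T yx (symmetric (subst T (sym xy) _)))
  ... | false | true  = ⊥-elim (subst T xy (symmetric (subst T (sym yx) _)))

  bit-irreflexive : ∀ x → bit (A x x) ≡ 0
  bit-irreflexive x with A x x in xx
  ... | true  = ⊥-elim (irreflexive (subst T (sym xx) _))
  ... | false = refl

  degree-++-∷ : ∀ p xs x ys → degree A p (xs ++ x ∷ ys) ≡ bit (A p x) + degree A p (xs ++ ys)
  degree-++-∷ p []       x ys = refl
  degree-++-∷ p (z ∷ xs) x ys rewrite degree-++-∷ p xs x ys =
    solve (bit (A p z)) (bit (A p x)) (degree A p (xs ++ ys))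
    where
    solve : ∀ a b c → a + (b + c) ≡ b + (a + c)
    solve = solve-∀

  edges-++-∷ : ∀ xs x ys → edges A (xs ++ x ∷ ys) ≡ degree A x (xs ++ ys) + edges A (xs ++ ys)
  edges-++-∷ []       x ys = refl
  edges-++-∷ (p ∷ xs) x ys
    rewrite edges-++-∷ xs x ys | degree-++-∷ p xs x ys | bit-symmetric p x =
    solve (bit (A x p)) (degree A p (xs ++ ys)) (degree A x (xs ++ ys)) (edges A (xs ++ ys))
    where
    solve : ∀ a b c d → (a + b) + (c + d) ≡ (a + c) + (b + d)
    solve = solve-∀

  -- Repeatedly deleting a vertex of degree below d keeps d * |U| < edges U.
  denseCore : ∀ ℓ d U → length U ≡ ℓ → Unique U → d * length U < edges A U →
              ∃ λ W → Unique W × (∃ λ v → v ∈ˡ W) × MinDegree A d W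
  denseCore zero    d [] _ _ ()
  denseCore (suc ℓ) d U |U| u dense with all? (λ x → d ≤? degree A x U) U
  denseCore (suc ℓ) d (v ∷ U) _ u dense | yes min = v ∷ U , u , (v , here refl) , lookup min
  denseCore (suc ℓ) d U |U| u dense | no ¬min with find (¬All⇒Any¬ (λ x → d ≤? degree A x U) U ¬min)
  ... | x , x∈U , low with ∈-∃++ x∈U
  ...   | ys , zs , refl = denseCore ℓ d (ys ++ zs) |U′| (Unique-++-∷⁻ ys u) dense′
    where
    |U′| : length (ys ++ zs) ≡ ℓ
    |U′| = ℕ.suc-injective (trans (sym (length-++-sucʳ ys x zs)) |U|)

    low′ : degree A x (ys ++ zs) < d
    low′ = subst (_< d) (trans (degree-++-∷ x ys x zs) (cong (_+ degree A x (ys ++ zs)) (bit-irreflexive x)))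
                 (ℕ.≰⇒> low)

    dense′ : d * length (ys ++ zs) < edges A (ys ++ zs)
    dense′ = ℕ.+-cancelˡ-< d _ _ (ℕ.<-≤-trans
      (subst₂ _<_ (trans (cong (d *_) (length-++-sucʳ ys x zs)) (ℕ.*-suc d _)) (edges-++-∷ ys x zs) dense)
      (ℕ.+-monoˡ-≤ _ (ℕ.<⇒≤ low′)))

module Branching {n : ℕ} {A : Fin n → Fin n → Bool} (simple : IsSimple A)
                 {t k : ℕ} (detourFree : DetourFree A t) (2k≤1+t : 2 * k ≤ suc t)
                 (c : ℕ) {U : List (Fin n)} (unique : Unique U) (v : Fin n) (v∈U : v ∈ˡ U)
                 (minDegree : MinDegree A (suc c) U) where

  open IsSimple simple

  neighbours : Fin n → List (Fin n)
  neighbours x = neighboursIn A x U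

  -- Among the first c + 1 neighbours of x, c choices avoid the predecessor pr.
  choose : Fin n → Fin n → Fin c → Fin n
  choose x pr a with nthOr x (neighbours x) (toℕ a) ≟ pr
  ... | yes _ = nthOr x (neighbours x) c
  ... | no _  = nthOr x (neighbours x) (toℕ a)

  module _ {x : Fin n} (x∈U : x ∈ˡ U) where

    private
      c<len : c < length (neighbours x)
      c<len = subst (c <_) (sym (length-neighboursIn A x U)) (minDegree x∈U)

      a<len : (a : Fin c) → toℕ a < length (neighbours x)
      a<len a = ℕ.<-trans (toℕ<n a) c<len

      inj : ∀ {i j} → i < length (neighbours x) → j < length (neighbours x) →
            nthOr x (neighbours x) i ≡ nthOr x (neighbours x) j → i ≡ j
      inj = nthOr-injective x (filter⁺ (λ y → T? (A x y)) unique)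

      choose-neighbour : ∀ pr a → choose x pr a ∈ˡ neighbours x
      choose-neighbour pr a with nthOr x (neighbours x) (toℕ a) ≟ pr
      ... | yes _ = nthOr-∈ x (neighbours x) c<len
      ... | no _  = nthOr-∈ x (neighbours x) (a<len a)

    choose-∈U : ∀ pr a → choose x pr a ∈ˡ U
    choose-∈U pr a = proj₁ (∈-filter⁻ (λ y → T? (A x y)) {xs = U} (choose-neighbour pr a))

    choose-adjacent : ∀ pr a → T (A x (choose x pr a))
    choose-adjacent pr a = proj₂ (∈-filter⁻ (λ y → T? (A x y)) {xs = U} (choose-neighbour pr a))

    choose-≢ : ∀ pr a → choose x pr a ≢ pr
    choose-≢ pr a with nthOr x (neighbours x) (toℕ a) ≟ pr
    ... | yes a≡pr = λ c≡pr → ℕ.<-irrefl (inj (a<len a) c<len (trans a≡pr (sym c≡pr))) (toℕ<n a)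
    ... | no a≢pr  = a≢pr

    choose-injective : ∀ pr {a a′} → choose x pr a ≡ choose x pr a′ → a ≡ a′
    choose-injective pr {a} {a′} eq
      with nthOr x (neighbours x) (toℕ a) ≟ pr | nthOr x (neighbours x) (toℕ a′) ≟ pr
    ... | yes a≡pr | yes a′≡pr = toℕ-injective (inj (a<len a) (a<len a′) (trans a≡pr (sym a′≡pr)))
    ... | no _     | no _      = toℕ-injective (inj (a<len a) (a<len a′) eq)
    ... | yes _    | no _      = ⊥-elim (ℕ.<-irrefl (inj (a<len a′) c<len (sym eq)) (toℕ<n a′))
    ... | no _     | yes _     = ⊥-elim (ℕ.<-irrefl (inj (a<len a) c<len eq) (toℕ<n a))

  -- SimplePath j (y ∷ p): a path of j edges from v inside U, listed backwards from its end y.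
  data SimplePath : ℕ → List (Fin n) → Set where
    start  : SimplePath 0 (v ∷ [])
    extend : ∀ {j x p y} → SimplePath j (x ∷ p) → T (A x y) → y ∈ˡ U → y ∉ˡ x ∷ p →
             SimplePath (suc j) (y ∷ x ∷ p)

  end∈U : ∀ {j x p} → SimplePath j (x ∷ p) → x ∈ˡ U
  end∈U start             = v∈U
  end∈U (extend _ _ y∈ _) = y∈

  start∈ : ∀ {j x p} → SimplePath j (x ∷ p) → v ∈ˡ x ∷ p
  start∈ start              = here refl
  start∈ (extend sp _ _ _) = there (start∈ sp)

  AwayFrom : Fin n → Fin n → Fin n → Set
  AwayFrom z x y = T (A x y) × x ≢ z × y ≢ z

  AwayFrom-sym : ∀ {z x y} → AwayFrom z x y → AwayFrom z y x
  AwayFrom-sym (xy , x≢z , y≢z) = symmetric xy , y≢z , x≢z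

  AwayFrom⇒OtherEdge : ∀ {z b x y} → AwayFrom z x y → OtherEdge A z b x y
  AwayFrom⇒OtherEdge (xy , x≢z , y≢z) = xy , x≢z ∘ proj₁ , y≢z ∘ proj₂

  walkBack : ∀ {j z q x y} → SimplePath j (z ∷ q) → x ∉ˡ z ∷ q → y ∈ˡ z ∷ q → Walk (AwayFrom x) j z y
  walkBack sp                  x∉ (here refl) = ε
  walkBack (extend sp xz _ _) x∉ (there y∈)  =
    (symmetric xz , (λ { refl → x∉ (here refl) }) , (λ { refl → x∉ (there (here refl)) }))
    ◅ walkBack sp (x∉ ∘ there) y∈

  end∉ : ∀ {j x p} → SimplePath j (x ∷ p) → x ∉ˡ p
  end∉ start             ()
  end∉ (extend _ _ _ y∉) = y∉

  no-chord : ∀ {j x pr rest y} → SimplePath (suc j) (x ∷ pr ∷ rest) → j < t → T (A x y) → y ∉ˡ rest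
  no-chord {pr = pr} {y = y} (extend sp pr~x _ x∉) j<t xy y∈rest =
    detourFree xy (weaken j<t ((symmetric pr~x , pr≢y ∘ proj₂ , x∉ ∘ here ∘ sym ∘ proj₂)
                               ◅ mapWalk AwayFrom⇒OtherEdge (walkBack sp x∉ (there y∈rest))))
    where
    pr≢y : pr ≢ y
    pr≢y refl = end∉ sp y∈rest

  -- At the start there is no predecessor; v is not its own neighbour, so avoiding it is vacuous.
  predecessor : List (Fin n) → Fin n
  predecessor []       = v
  predecessor (pr ∷ _) = pr

  <k⇒≤t : ∀ {j} → j < k → j ≤ t
  <k⇒≤t j<k = ℕ.≤-pred (ℕ.≤-trans j<k (ℕ.≤-trans (ℕ.m≤m+n k (k + 0)) 2k≤1+t))

  choose-fresh : ∀ {j x p} (sp : SimplePath j (x ∷ p)) → j < k → ∀ a →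
                 choose x (predecessor p) a ∉ˡ x ∷ p
  choose-fresh {x = x} sp _ a (here y≡x) =
    irreflexive (subst (T ∘ A x) y≡x (choose-adjacent (end∈U sp) _ a))
  choose-fresh {p = pr ∷ _} sp _ a (there (here y≡pr)) = choose-≢ (end∈U sp) pr a y≡pr
  choose-fresh {p = pr ∷ _} sp@(extend _ _ _ _) j<k a (there (there y∈rest)) =
    no-chord sp (<k⇒≤t j<k) (choose-adjacent (end∈U sp) pr a) y∈rest

  Ray : ℕ → Set
  Ray j = Σ (Fin n) λ x → Σ (List (Fin n)) λ p → SimplePath j (x ∷ p)

  trace : ∀ {j} → Ray j → List (Fin n)
  trace (x , p , _) = x ∷ p

  extendBy : ∀ {j} → j < k → Ray j → Fin c → Ray (suc j)
  extendBy j<k (x , p , sp) a =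
    choose x (predecessor p) a , x ∷ p ,
    extend sp (choose-adjacent (end∈U sp) _ a) (choose-∈U (end∈U sp) _ a) (choose-fresh sp j<k a)

  extendBy-injective : ∀ {j} (j<k : j < k) (ρ : Ray j) {a a′} →
                       proj₁ (extendBy j<k ρ a) ≡ proj₁ (extendBy j<k ρ a′) → a ≡ a′
  extendBy-injective j<k (x , p , sp) = choose-injective (end∈U sp) (predecessor p)

  grow : ∀ j → j ≤ k → Fin (c ^ j) → Ray j
  grow zero    _   _ = v , [] , start
  grow (suc j) j<k i =
    extendBy j<k (grow j (ℕ.<⇒≤ j<k) (proj₂ (remQuot {c} (c ^ j) i))) (proj₁ (remQuot {c} (c ^ j) i))

  grow-injective : ∀ j (j≤k : j ≤ k) i i′ → trace (grow j j≤k i) ≡ trace (grow j j≤k i′) → i ≡ i′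
  grow-injective zero    _   zero zero _ = refl
  grow-injective (suc j) j<k i i′ eq = begin
    i                                         ≡⟨ combine-remQuot {c} (c ^ j) i ⟨
    uncurry combine (remQuot {c} (c ^ j) i)   ≡⟨ cong₂ combine a≡a′ r≡r′ ⟩
    uncurry combine (remQuot {c} (c ^ j) i′)  ≡⟨ combine-remQuot {c} (c ^ j) i′ ⟩
    i′                                        ∎
    where
    open ≡-Reasoning
    ray : Fin (c ^ j) → Ray j
    ray = grow j (ℕ.<⇒≤ j<k)

    r≡r′ : proj₂ (remQuot {c} (c ^ j) i) ≡ proj₂ (remQuot {c} (c ^ j) i′)
    r≡r′ = grow-injective j (ℕ.<⇒≤ j<k) _ _ (∷-injectiveʳ eq)

    a≡a′ : proj₁ (remQuot {c} (c ^ j) i) ≡ proj₁ (remQuot {c} (c ^ j) i′)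
    a≡a′ = extendBy-injective j<k (ray (proj₂ (remQuot {c} (c ^ j) i)))
             (trans (∷-injectiveˡ eq)
                    (cong (λ r → proj₁ (extendBy j<k (ray r) (proj₁ (remQuot {c} (c ^ j) i′)))) (sym r≡r′)))

  -- Two different paths of length j ≤ k from v to y close up a detour of length 2j - 1 ≤ t.
  same-end : ∀ {j x p y q} → SimplePath j (x ∷ p) → SimplePath j (y ∷ q) → x ≡ y → j ≤ k →
             x ∷ p ≡ y ∷ q
  same-end start start refl _ = refl
  same-end {suc j} {y} (extend {x = x₁} sp₁ x₁y _ y∉₁) (extend {x = x₂} sp₂ x₂y _ y∉₂) refl j<k
    with x₁ ≟ x₂
  ... | yes refl = cong (y ∷_) (same-end sp₁ sp₂ refl (ℕ.<⇒≤ j<k))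
  ... | no x₁≢x₂ = ⊥-elim (detourFree (symmetric x₁y) (weaken 1+2j≤t (first ◅ (back₂ ◅◅ back₁))))
    where
    first : OtherEdge A _ x₁ _ x₂
    first = symmetric x₂y , x₁≢x₂ ∘ sym ∘ proj₂ , y∉₁ ∘ here ∘ proj₁
    back₂ : Walk (OtherEdge A y x₁) j x₂ v
    back₂ = mapWalk AwayFrom⇒OtherEdge (walkBack sp₂ y∉₂ (start∈ sp₂))
    back₁ : Walk (OtherEdge A y x₁) j v x₁
    back₁ = mapWalk AwayFrom⇒OtherEdge (reverse AwayFrom-sym (walkBack sp₁ y∉₁ (start∈ sp₁)))
    1+2j≤t : suc (j + j) ≤ t
    1+2j≤t = ℕ.≤-pred (ℕ.≤-trans (ℕ.≤-reflexive (solve j)) (ℕ.≤-trans (ℕ.*-monoʳ-≤ 2 j<k) 2k≤1+t))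
      where
      solve : ∀ j → suc (suc (j + j)) ≡ 2 * suc j
      solve = solve-∀

  branching : c ^ k ≤ n
  branching = injective⇒≤ {f = proj₁ ∘ ray} λ {i} {i′} end≡ →
    grow-injective k ℕ.≤-refl i i′ (same-end (proj₂ (proj₂ (ray i))) (proj₂ (proj₂ (ray i′))) end≡ ℕ.≤-refl)
    where
    ray : Fin (c ^ k) → Ray k
    ray = grow k ℕ.≤-refl

^-distribʳ-* : ∀ a b k → (a * b) ^ k ≡ a ^ k * b ^ k
^-distribʳ-* a b zero    = refl
^-distribʳ-* a b (suc k) rewrite ^-distribʳ-* a b k = solve a b (a ^ k) (b ^ k)
  where
  solve : ∀ a b x y → a * b * (x * y) ≡ a * x * (b * y)
  solve = solve-∀

private
  ^≤4^k*n : ∀ k {n a} → a ≤ 4 → 1 ≤ n → a ^ k ≤ 4 ^ k * n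
  ^≤4^k*n k a≤4 1≤n = ℕ.≤-trans (ℕ.^-monoˡ-≤ k a≤4)
    (ℕ.≤-trans (ℕ.≤-reflexive (sym (ℕ.*-identityʳ (4 ^ k)))) (ℕ.*-monoʳ-≤ (4 ^ k) 1≤n))

  quotient-bound : ∀ k n q → 1 ≤ n → (∀ x → q ≡ 3 + x → suc x ^ k ≤ n) → suc q ^ k ≤ 4 ^ k * n
  quotient-bound k n 0 1≤n _ = ^≤4^k*n k (s≤s z≤n) 1≤n
  quotient-bound k n 1 1≤n _ = ^≤4^k*n k (s≤s (s≤s z≤n)) 1≤n
  quotient-bound k n 2 1≤n _ = ^≤4^k*n k (s≤s (s≤s (s≤s z≤n))) 1≤n
  quotient-bound k n (suc (suc (suc x))) _ large = begin
    (4 + x) ^ k          ≤⟨ ℕ.^-monoˡ-≤ k (ℕ.m≤m+n (4 + x) (3 * x)) ⟩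
    (4 + x + 3 * x) ^ k  ≡⟨ cong (_^ k) (solve x) ⟩
    (4 * suc x) ^ k      ≡⟨ ^-distribʳ-* 4 (suc x) k ⟩
    4 ^ k * suc x ^ k    ≤⟨ ℕ.*-monoʳ-≤ (4 ^ k) (large x refl) ⟩
    4 ^ k * n            ∎
    where
    open ℕ.≤-Reasoning
    solve : ∀ x → 4 + x + 3 * x ≡ 4 * suc x
    solve = solve-∀

-- With q = E / n, the hypothesis at c = q - 2 gives (q - 2) ^ k ≤ n, and E < (q + 1) * n.
edge-count-bound : ∀ k n E → 1 ≤ k → (∀ c → suc c * n < E → c ^ k ≤ n) → E ^ k ≤ 4 ^ k * n ^ (k + 1)
edge-count-bound (suc k) zero    zero    _ _     = z≤n
edge-count-bound k       zero    (suc E) _ moore =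
  contradiction (moore 1 (s≤s z≤n)) (subst (_≰ 0) (sym (ℕ.^-zeroˡ k)) λ ())
edge-count-bound k       n@(suc _) E     _ moore = begin
  E ^ k                  ≤⟨ ℕ.^-monoˡ-≤ k E≤ ⟩
  (suc q * n) ^ k        ≡⟨ ^-distribʳ-* (suc q) n k ⟩
  suc q ^ k * n ^ k      ≤⟨ ℕ.*-monoˡ-≤ (n ^ k) (quotient-bound k n q (s≤s z≤n) large) ⟩
  4 ^ k * n * n ^ k      ≡⟨ ℕ.*-assoc (4 ^ k) n (n ^ k) ⟩
  4 ^ k * n ^ (1 + k)    ≡⟨ cong (λ e → 4 ^ k * n ^ e) (ℕ.+-comm 1 k) ⟩
  4 ^ k * n ^ (k + 1)    ∎
  where
  open ℕ.≤-Reasoning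
  q : ℕ
  q = E / n

  E≤ : E ≤ suc q * n
  E≤ = ℕ.≤-trans (ℕ.≤-reflexive (m≡m%n+[m/n]*n E n)) (ℕ.+-monoˡ-≤ (q * n) (ℕ.<⇒≤ (m%n<n E n)))

  large : ∀ x → q ≡ 3 + x → suc x ^ k ≤ n
  large x q≡ = moore (suc x) (ℕ.<-≤-trans (ℕ.*-monoˡ-< n (ℕ.n<1+n (2 + x)))
                                          (subst (λ q → q * n ≤ E) q≡ (m/n*n≤m E n)))

module _ {n : ℕ} {A : Fin n → Fin n → Bool} (simple : IsSimple A)
         {t k : ℕ} (detourFree : DetourFree A t) (2k≤1+t : 2 * k ≤ suc t) where

  moore : ∀ c → suc c * n < edges A (allFin n) → c ^ k ≤ n
  moore c dense with Pruning.denseCore simple n (suc c) (allFin n) |V| (allFin⁺ n)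
                                     (subst (λ m → suc c * m < edges A (allFin n)) (sym |V|) dense)
    where
    |V| : length (allFin n) ≡ n
    |V| = length-tabulate id
  ... | U , unique , (v , v∈U) , minDegree =
    Branching.branching simple {k = k} detourFree 2k≤1+t c unique v v∈U minDegree

  edges-bound : 1 ≤ k → edges A (allFin n) ^ k ≤ 4 ^ k * n ^ (k + 1)
  edges-bound 1≤k = edge-count-bound k n (edges A (allFin n)) 1≤k moore

-- The greedy spanner

module _ {n : ℕ} (H : Hypergraph n) where

  private
    M : ℕ
    M = m H

    w : Fin M → ℚ
    w = weight H

  Spans : Fin n → Fin n → Fin M → Set
  Spans x y h = x ∈ edge H h × y ∈ edge H h

  spans? : ∀ x y h → Dec (Spans x y h)
  spans? x y h = x Subset.∈? edge H h ×-dec y Subset.∈? edge H h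

  lightestOf : List (Fin M) → Maybe (Fin M)
  lightestOf []       = nothing
  lightestOf (h ∷ hs) = just (Extrema.argmin w h hs)

  lightest : Fin n → Fin n → Maybe (Fin M)
  lightest x y = lightestOf (filter (spans? x y) (allFin M))

  lightestOf-∈ : ∀ hs {h} → lightestOf hs ≡ just h → h ∈ˡ hs
  lightestOf-∈ (h′ ∷ hs) refl with Extrema.argmin-sel w h′ hs
  ... | inj₁ ≡h′ = here ≡h′
  ... | inj₂ ∈hs = there ∈hs

  lightestOf-≤ : ∀ {hs h′} → h′ ∈ˡ hs → ∃ λ h → lightestOf hs ≡ just h × w h ℚ.≤ w h′
  lightestOf-≤ {h ∷ hs} (here refl) = _ , refl , Extrema.f[argmin]≤f[⊤] {f = w} h hs
  lightestOf-≤ {h ∷ hs} (there h′∈) = _ , refl , All.lookup (Extrema.f[argmin]≤f[xs] {f = w} h hs) h′∈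

  lightest-spans : ∀ {x y h} → lightest x y ≡ just h → Spans x y h
  lightest-spans {x} {y} eq = proj₂ (∈-filter⁻ (spans? x y) {xs = allFin M} (lightestOf-∈ _ eq))

  lightest-≤ : ∀ {x y h′} → Spans x y h′ → ∃ λ h → lightest x y ≡ just h × w h ℚ.≤ w h′
  lightest-≤ {x} {y} {h′} spans = lightestOf-≤ (∈-filter⁺ (spans? x y) (∈-allFin h′) spans)

  Candidate : Set
  Candidate = Fin n × Fin n × Fin M

  key : Candidate → ℚ
  key (_ , _ , h) = w h

  Valid : Candidate → Set
  Valid (u , v , h) = Spans u v h

  valid? : ∀ c → Dec (Valid c)
  valid? (u , v , h) = spans? u v h

  module ByWeight = Sort (On.decTotalOrder ℚ.≤-decTotalOrder key)

  triples : List Candidate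
  triples = cartesianProduct (allFin n) (cartesianProduct (allFin n) (allFin M))

  validTriples : List Candidate
  validTriples = filter valid? triples

  candidates : List Candidate
  candidates = ByWeight.sort validTriples

  candidates-sorted : AllPairs (λ c d → key c ℚ.≤ key d) candidates
  candidates-sorted = Linked⇒AllPairs ℚ.≤-trans (ByWeight.sort-↗ _)

  candidates-valid : All Valid candidates
  candidates-valid = All-resp-↭ (↭-sym (ByWeight.sort-↭ validTriples)) (all-filter valid? triples)

  candidates-complete : ∀ {u v h} → Spans u v h → (u , v , h) ∈ˡ candidates
  candidates-complete {u} {v} {h} spans = ∈-resp-↭ (↭-sym (ByWeight.sort-↭ validTriples))
    (∈-filter⁺ valid?
               (∈-cartesianProduct⁺ (∈-allFin u) (∈-cartesianProduct⁺ (∈-allFin v) (∈-allFin h))) spans)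

Adjacency : ℕ → Set
Adjacency n = Fin n → Fin n → Bool

empty : ∀ {n} → Adjacency n
empty _ _ = false

Edge : ∀ {n} → Adjacency n → Fin n → Fin n → Set
Edge A x y = T (A x y)

module _ {n : ℕ} where

  connect : Adjacency n → Fin n → Fin n → Adjacency n
  connect A u v x y = A x y ∨ ⌊ (x ≟ u ×-dec y ≟ v) ⊎-dec (x ≟ v ×-dec y ≟ u) ⌋

  connect⁻ : ∀ {A u v x y} → T (connect A u v x y) → T (A x y) ⊎ ((x ≡ u × y ≡ v) ⊎ (x ≡ v × y ≡ u))
  connect⁻ = Sum.map₂ toWitness ∘ Equivalence.to T-∨

  connect⁺ : ∀ {A u v x y} → T (A x y) ⊎ ((x ≡ u × y ≡ v) ⊎ (x ≡ v × y ≡ u)) → T (connect A u v x y)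
  connect⁺ = Equivalence.from T-∨ ∘ Sum.map₂ fromWitness

  walk? : ∀ A ℓ u v → Dec (Walk (Edge {n} A) ℓ u v)
  walk? A ℓ u v with u ≟ v
  ... | yes refl = yes ε
  walk? A zero    u v | no u≢v = no λ { ε → u≢v refl }
  walk? A (suc ℓ) u v | no u≢v with any? (λ x → T? (A u x) ×-dec walk? A ℓ x v)
  ... | yes (x , ux , w) = yes (ux ◅ w)
  ... | no ∄x             = no λ { ε → u≢v refl ; (ux ◅ w) → ∄x (_ , ux , w) }

module Greedy {n : ℕ} (H : Hypergraph n) (t : ℕ) where

  private
    w : Fin (m H) → ℚ
    w = weight H

  greedy : List (Candidate H) → Adjacency n → Adjacency n
  greedy []                A = A
  greedy ((u , v , _) ∷ cs) A with walk? A t u v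
  ... | yes _ = greedy cs A
  ... | no _  = greedy cs (connect A u v)

  LightEdge : Adjacency n → ℚ → Fin n → Fin n → Set
  LightEdge A q x y = T (A x y) × ∃ λ h → Spans H x y h × w h ℚ.≤ q

  record Invariant (A : Adjacency n) (cs : List (Candidate H)) : Set where
    field
      simple     : IsSimple A
      detourFree : DetourFree A t
      light      : ∀ {x y} → T (A x y) → ∃ λ h → Spans H x y h × All (λ c → w h ℚ.≤ key H c) cs

  open Invariant

  Invariant-tail : ∀ {A c cs} → Invariant A (c ∷ cs) → Invariant A cs
  Invariant-tail inv = record
    { simple     = simple inv
    ; detourFree = detourFree inv
    ; light      = λ xy → let h , spans , bounds = light inv xy in h , spans , All.tail bounds
    }

  module Connect {A u v h cs} (inv : Invariant A ((u , v , h) ∷ cs)) (spans : Spans H u v h)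
                 (sorted : All (λ c → w h ℚ.≤ key H c) cs) (¬walk : ¬ Walk (Edge A) t u v) where

    open IsSimple (simple inv)

    A′ : Adjacency n
    A′ = connect A u v

    IsEnd : Fin n → Set
    IsEnd z = z ≡ u ⊎ z ≡ v

    symmetric′ : ∀ {x y} → T (A′ x y) → T (A′ y x)
    symmetric′ xy with connect⁻ {A = A} xy
    ... | inj₁ old                  = connect⁺ {A = A} (inj₁ (symmetric old))
    ... | inj₂ (inj₁ (refl , refl)) = connect⁺ {A = A} (inj₂ (inj₂ (refl , refl)))
    ... | inj₂ (inj₂ (refl , refl)) = connect⁺ {A = A} (inj₂ (inj₁ (refl , refl)))

    irreflexive′ : ∀ {x} → ¬ T (A′ x x)
    irreflexive′ xx with connect⁻ {A = A} xx
    ... | inj₁ old                  = irreflexive old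
    ... | inj₂ (inj₁ (refl , refl)) = ¬walk ε
    ... | inj₂ (inj₂ (refl , refl)) = ¬walk ε

    light′ : ∀ {x y} → T (A′ x y) → ∃ λ h → Spans H x y h × All (λ c → w h ℚ.≤ key H c) cs
    light′ xy with connect⁻ {A = A} xy
    ... | inj₁ old                  = let h′ , spans′ , bounds = light inv old in h′ , spans′ , All.tail bounds
    ... | inj₂ (inj₁ (refl , refl)) = h , spans , sorted
    ... | inj₂ (inj₂ (refl , refl)) = h , (proj₂ spans , proj₁ spans) , sorted

    not-new : ∀ {a b x y} → (a ≡ u × b ≡ v) ⊎ (a ≡ v × b ≡ u) → OtherEdge A′ a b x y → T (A x y)
    not-new ab≡ (xy , ≢ab , ≢ba) with connect⁻ {A = A} xy | ab≡
    ... | inj₁ old              | _                      = old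
    ... | inj₂ (inj₁ xy≡uv)     | inj₁ (refl , refl) = ⊥-elim (≢ab xy≡uv)
    ... | inj₂ (inj₂ xy≡vu)     | inj₁ (refl , refl) = ⊥-elim (≢ba xy≡vu)
    ... | inj₂ (inj₁ xy≡uv)     | inj₂ (refl , refl) = ⊥-elim (≢ba xy≡uv)
    ... | inj₂ (inj₂ xy≡vu)     | inj₂ (refl , refl) = ⊥-elim (≢ab xy≡vu)

    old-or-new : ∀ {a b x y} → OtherEdge A′ a b x y → OtherEdge A a b x y ⊎ (IsEnd x × IsEnd y)
    old-or-new (xy , ≢ab , ≢ba) with connect⁻ {A = A} xy
    ... | inj₁ old                  = inj₁ (old , ≢ab , ≢ba)
    ... | inj₂ (inj₁ (refl , refl)) = inj₂ (inj₁ refl , inj₂ refl)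
    ... | inj₂ (inj₂ (refl , refl)) = inj₂ (inj₂ refl , inj₁ refl)

    ¬walk-between-ends : ∀ {x y ℓ} → IsEnd x → IsEnd y → x ≢ y → ℓ ≤ t → ¬ Walk (Edge A) ℓ x y
    ¬walk-between-ends (inj₁ refl) (inj₁ refl) x≢y _ _ = x≢y refl
    ¬walk-between-ends (inj₂ refl) (inj₂ refl) x≢y _ _ = x≢y refl
    ¬walk-between-ends (inj₁ refl) (inj₂ refl) _ ℓ≤t w = ¬walk (weaken ℓ≤t w)
    ¬walk-between-ends (inj₂ refl) (inj₁ refl) _ ℓ≤t w = ¬walk (weaken ℓ≤t (reverse symmetric w))

    -- A detour around an old edge ab through the new edge uv yields either a shorter detour
    -- avoiding uv or a walk between u and v through ab.
    detourFree′ : DetourFree A′ t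
    detourFree′ ab detour with connect⁻ {A = A} ab
    ... | inj₂ (inj₁ (refl , refl)) = ¬walk (mapWalk (not-new (inj₁ (refl , refl))) detour)
    ... | inj₂ (inj₂ (refl , refl)) = ¬walk (reverse symmetric (mapWalk (not-new (inj₂ (refl , refl))) detour))
    ... | inj₁ old with split-by old-or-new detour
    ...   | inj₁ old-detour = detourFree inv old old-detour
    ...   | inj₂ (x₁ , y₂ , p , r , end₁ , end₂ , pre , suf , 1+p+r≤t) with x₁ ≟ y₂
    ...     | yes refl = detourFree inv old (weaken (ℕ.≤-trans (ℕ.n≤1+n _) 1+p+r≤t) (pre ◅◅ suf))
    ...     | no x₁≢y₂ =
      ¬walk-between-ends end₁ end₂ x₁≢y₂ (ℕ.≤-trans (ℕ.≤-reflexive (ℕ.+-suc p r)) 1+p+r≤t)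
        (reverse symmetric (mapWalk proj₁ pre) ◅◅ (old ◅ reverse symmetric (mapWalk proj₁ suf)))

    invariant : Invariant A′ cs
    invariant = record
      { simple     = record { symmetric = symmetric′ ; irreflexive = irreflexive′ }
      ; detourFree = detourFree′
      ; light      = light′
      }

  Complete : Adjacency n → List (Candidate H) → Set
  Complete A cs = ∀ {u v h} → (u , v , h) ∈ˡ cs → Walk (LightEdge A (w h)) t u v

  greedy-correct : 1 ≤ t → ∀ cs A → AllPairs (λ c d → key H c ℚ.≤ key H d) cs → All (Valid H) cs →
                   Invariant A cs →
                   Invariant (greedy cs A) [] × (∀ {x y} → T (A x y) → T (greedy cs A x y)) ×
                   Complete (greedy cs A) cs
  greedy-correct _ [] A _ _ inv = inv , id , λ ()
  greedy-correct 1≤t ((u , v , h) ∷ cs) A (sorted ∷ sorteds) (spans ∷ valids) inv with walk? A t u v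
  ... | yes walk =
    let final , grows , complete = greedy-correct 1≤t cs A sorteds valids (Invariant-tail inv)
        lightStep : ∀ {x y} → T (A x y) → LightEdge (greedy cs A) (w h) x y
        lightStep xy = let h′ , spans′ , bounds = light inv xy in grows xy , h′ , spans′ , All.head bounds
    in final , grows , λ { (here refl) → mapWalk lightStep walk ; (there c∈) → complete c∈ }
  ... | no ¬walk =
    let final , grows , complete = greedy-correct 1≤t cs (connect A u v) sorteds valids
                                     (Connect.invariant inv spans sorted ¬walk)
        uv : T (greedy cs (connect A u v) u v)
        uv = grows (connect⁺ {A = A} (inj₂ (inj₁ (refl , refl))))
    in final , grows ∘ connect⁺ {A = A} ∘ inj₁ ,
       λ { (here refl) → weaken 1≤t ((uv , h , spans , ℚ.≤-refl) ◅ ε) ; (there c∈) → complete c∈ }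

module Spanner {n : ℕ} (H : Hypergraph n) (nonneg : NonnegWeights H) (k : ℕ) (1≤k : 1 ≤ k) where

  private
    M : ℕ
    M = m H

    w : Fin M → ℚ
    w = weight H

  t : ℕ
  t = 2 * k ∸ 1

  2k≡1+t : 2 * k ≡ suc t
  2k≡1+t = 2k≡1+[2k∸1] 1≤k

  1≤t : 1 ≤ t
  1≤t = ℕ.≤-pred (subst (2 ≤_) 2k≡1+t (ℕ.*-monoʳ-≤ 2 1≤k))

  open Greedy H t

  empty-invariant : Invariant empty (candidates H)
  empty-invariant = record
    { simple     = record { symmetric = λ () ; irreflexive = λ () }
    ; detourFree = λ ()
    ; light      = λ ()
    }

  G : Adjacency n
  G = greedy (candidates H) empty

  private
    G-correct : Invariant G [] × (∀ {x y} → T (empty x y) → T (G x y)) × Complete G (candidates H)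
    G-correct = greedy-correct 1≤t (candidates H) empty (candidates-sorted H) (candidates-valid H) empty-invariant

  G-invariant : Invariant G []
  G-invariant = proj₁ G-correct

  G-complete : Complete G (candidates H)
  G-complete = proj₂ (proj₂ G-correct)

  open IsSimple (Invariant.simple G-invariant)

  spannerList : List (Fin n) → List (Fin M)
  spannerList []      = []
  spannerList (x ∷ U) = mapMaybe (lightest H x) (neighboursIn G x U) ++ spannerList U

  length-spannerList : ∀ U → length (spannerList U) ≤ edges G U
  length-spannerList []      = z≤n
  length-spannerList (x ∷ U) = begin
    length (mapMaybe (lightest H x) N ++ spannerList U)         ≡⟨ length-++ (mapMaybe (lightest H x) N) ⟩
    length (mapMaybe (lightest H x) N) + length (spannerList U)
      ≤⟨ ℕ.+-mono-≤ (length-mapMaybe (lightest H x) N) (length-spannerList U) ⟩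
    length N + edges G U                                        ≡⟨ cong (_+ edges G U) (length-neighboursIn G x U) ⟩
    degree G x U + edges G U                                    ∎
    where
    open ℕ.≤-Reasoning
    N : List (Fin n)
    N = neighboursIn G x U

  private
    via-lightest : ∀ {x y U h′} → y ∈ˡ U → T (G x y) → Spans H x y h′ →
                   ∃ λ h → h ∈ˡ mapMaybe (lightest H x) (neighboursIn G x U) × Spans H x y h × w h ℚ.≤ w h′
    via-lightest {x} {y} y∈U xy spans′ with lightest-≤ H spans′
    ... | h , eq , h≤h′ = h , ∈-mapMaybe⁺ (lightest H x) (∈-filter⁺ (λ z → T? (G x z)) y∈U xy) eq ,
                          lightest-spans H eq , h≤h′

  spannerList-covers : ∀ U {x y h′} → x ∈ˡ U → y ∈ˡ U → T (G x y) → Spans H x y h′ →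
                       ∃ λ h → h ∈ˡ spannerList U × Spans H x y h × w h ℚ.≤ w h′
  spannerList-covers (z ∷ U) (here refl) (here refl) xx _ = ⊥-elim (irreflexive xx)
  spannerList-covers (z ∷ U) (here refl) (there y∈U) xy spans′ =
    let h , h∈ , spans , h≤h′ = via-lightest y∈U xy spans′ in h , ∈-++⁺ˡ h∈ , spans , h≤h′
  spannerList-covers (z ∷ U) (there x∈U) (here refl) xy (x∈ , y∈) =
    let h , h∈ , (y∈h , x∈h) , h≤h′ = via-lightest x∈U (symmetric xy) (y∈ , x∈)
    in h , ∈-++⁺ˡ h∈ , (x∈h , y∈h) , h≤h′
  spannerList-covers (z ∷ U) (there x∈U) (there y∈U) xy spans′ =
    let h , h∈ , spans , h≤h′ = spannerList-covers U x∈U y∈U xy spans′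
    in h , ∈-++⁺ʳ _ h∈ , spans , h≤h′

  S : Subset M
  S = fromList (spannerList (allFin n))

  lightWalk⇒path : ∀ {q ℓ x y} → 0ℚ ℚ.≤ q → Walk (LightEdge G q) ℓ x y →
                   Σ ℚ λ L → PathSub H S x y L × L ℚ.≤ ℕ→ℚ ℓ ℚ.* q
  lightWalk⇒path {ℓ = ℓ} 0≤q ε = 0ℚ , [] , *-nonNeg (ℕ→ℚ-nonNeg ℓ) 0≤q
  lightWalk⇒path {q} {suc ℓ} 0≤q ((xy , h′ , spans′ , h′≤q) ◅ walk) with lightWalk⇒path 0≤q walk
  ... | L , P , L≤ with spannerList-covers (allFin n) (∈-allFin _) (∈-allFin _) xy spans′
  ...   | h , h∈ , (x∈ , y∈) , h≤h′ =
    w h ℚ.+ L , cons h (∈-fromList h∈) x∈ y∈ P ,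
    ℚ.≤-trans (ℚ.+-mono-≤ (ℚ.≤-trans h≤h′ h′≤q) L≤) (ℚ.≤-reflexive (sym (ℕ→ℚ-suc-* ℓ q)))

  hyperedge-detour : ∀ {x y h′} → Spans H x y h′ →
                     Σ ℚ λ L → PathSub H S x y L × L ℚ.≤ ℕ→ℚ t ℚ.* w h′
  hyperedge-detour {h′ = h′} spans′ = lightWalk⇒path (nonneg h′) (G-complete (candidates-complete H spans′))

  spanner : IsHyperspanner t H S
  spanner _ _ _ = stretch
    where
    stretch : ∀ {u v L} → PathH H u v L → Σ ℚ λ L′ → PathSub H S u v L′ × L′ ℚ.≤ ℕ→ℚ t ℚ.* L
    stretch [] = 0ℚ , [] , ℚ.≤-reflexive (sym (ℚ.*-zeroʳ (ℕ→ℚ t)))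
    stretch (cons {L = L} h _ u∈ x∈ rest) with hyperedge-detour (u∈ , x∈) | stretch rest
    ... | L₁ , P₁ , L₁≤ | L₂ , P₂ , L₂≤ =
      L₁ ℚ.+ L₂ , P₁ ++ᴾ P₂ ,
      ℚ.≤-trans (ℚ.+-mono-≤ L₁≤ L₂≤) (ℚ.≤-reflexive (sym (ℚ.*-distribˡ-+ (ℕ→ℚ t) (w h) L)))

  size : ∣ S ∣ ^ k ≤ 4 ^ k * n ^ (k + 1)
  size = ℕ.≤-trans
    (ℕ.^-monoˡ-≤ k (ℕ.≤-trans (∣fromList∣≤length (spannerList (allFin n))) (length-spannerList (allFin n))))
    (edges-bound (Invariant.simple G-invariant) (Invariant.detourFree G-invariant) (ℕ.≤-reflexive 2k≡1+t) 1≤k)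

lemma2 : ErdosGirthConjecture →
    ∀ (k : ℕ) → 1 ≤ k →
    -- upper bound: every n-vertex hypergraph with nonnegative weights has a
    -- (2k-1)-hyperspanner with ≤ C · n^{1+1/k} hyperedges
    (Σ ℕ λ C → ∀ (n : ℕ) (H : Hypergraph n) → NonnegWeights H →
       Σ (Subset (m H)) λ S → IsHyperspanner (2 * k ∸ 1) H S ×
         (∣ S ∣ ^ k ≤ C ^ k * n ^ (k + 1)))
    ×
    -- tightness: for all large n there is an n-vertex hypergraph every
    -- (2k-1)-hyperspanner of which has ≥ n^{1+1/k} / D hyperedges
    (Σ ℕ λ D → 1 ≤ D × Σ ℕ λ n₀ → ∀ (n : ℕ) → n₀ ≤ n →
       Σ (Hypergraph n) λ H → NonnegWeights H ×
         (∀ (S : Subset (m H)) → IsHyperspanner (2 * k ∸ 1) H S →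
            n ^ (k + 1) ≤ D ^ k * ∣ S ∣ ^ k))
lemma2 egc k 1≤k =
  (4 , λ n H nonneg → let open Spanner H nonneg k 1≤k in S , spanner , size) ,
  (let D , 1≤D , n₀ , dense-graphs = egc k 1≤k
   in D , 1≤D , n₀ , λ n n₀≤n → large-girth-hypergraph 1≤k (dense-graphs n n₀≤n))
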